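{- Let $\Sigma=S_1\ast\dots\ast S_n$ be a spatial conjunction and $s$ a stack with $s\models\mathrm{WellFormed}(\Sigma)$. Then there is a heap $h$ such that $s,h\models\Sigma$ and $\mathrm{dom}\,h=\{\,s(\mathrm{Addr}(S_i)) \mid 1\le i\le n,\ s\models\lnot\mathrm{Empty}(S_i)\,\}$.
   Context: Setting: a many-sorted first-order language with sorts including $\mathsf{Int}$ and $\mathsf{Bool}$, equality $\simeq$, classical boolean connectives and possibly further theory symbols. A stack $s$ maps variables to values of their sorts and is extended to pure (spatial-symbol-free) expressions; for a pure formula $F$, $s\models F$ means $s(F)=\top$. A heap is a partial function $h\colon\mathbb{Z}\rightharpoonup\mathsf{Val}$; $h=h_1\ast\dots\ast h_n$ means $h$ is the union of the $h_i$ with pairwise disjoint domains. Spatial predicates: $\mathrm{emp}$, $\mathrm{next}(x,y)$, $\mathrm{lseg}(x,y)$ with $x,y$ pure $\mathsf{Int}$ expressions. Semantics: $s,h\models\mathrm{emp}$ iff $h=\emptyset$; $s,h\models\mathrm{next}(x,y)$ iff $h=\{s(x)\mapsto s(y)\}$; $s,h\models F_1\ast F_2$ iff $h=h_1\ast h_2$ with $s,h_i\models F_i$ (empty conjunction means $\mathrm{emp}$); $s,h\models\mathrm{lseg}(x,z)$ iff there are $n\ge0$ and integers $a_0,\dots,a_n$ with $a_0=s(x)$, $a_n=s(z)$, $a_i\ne s(z)$ for $i<n$ and $h=\{a_0\mapsto a_1\}\ast\dots\ast\{a_{n-1}\mapsto a_n\}$. Definitions: $\mathrm{Empty}(\mathrm{emp})=\top$,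 $\mathrm{Empty}(\mathrm{next}(x,y))=\bot$, $\mathrm{Empty}(\mathrm{lseg}(x,y))=(x\simeq y)$; $\mathrm{Addr}(\mathrm{next}(x,y))=\mathrm{Addr}(\mathrm{lseg}(x,y))=x$. $\mathrm{Collide}(S,S')=\lnot\mathrm{Empty}(S)\land\lnot\mathrm{Empty}(S')\land\mathrm{Addr}(S)\simeq\mathrm{Addr}(S')$ ($\bot$ if either is $\mathrm{emp}$). $\mathrm{WellFormed}(S_1\ast\dots\ast S_n)=\bigwedge_{1\le i<j\le n}\lnot\mathrm{Collide}(S_i,S_j)$. -}

module Defs where

open import Data.Bool using (Bool; true; false; not; _∧_; if_then_else_)
open import Data.Integer using (ℤ)
import Data.Integer as ℤ
open import Data.Maybe using (Maybe; just; nothing)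
open import Data.List using (List; []; _∷_; tabulate)
open import Data.Fin using (Fin; zero; suc; fromℕ; inject₁)
open import Data.Nat using (ℕ)
open import Data.Product using (Σ; ∃; ∃-syntax; _×_; _,_)
open import Data.Sum using (_⊎_)
open import Relation.Nullary using (¬_; does)
open import Relation.Binary.PropositionalEquality using (_≡_; _≢_)

-- A pure Int expression is modelled semantically by its evaluation
-- function (this covers arbitrary theory symbols, variables, sorts).

IntExpr : Set → Set
IntExpr Stack = Stack → ℤ

-- Pure formulas (only the connectives needed for Empty / Collide /
-- WellFormed; atoms are equalities of Int expressions).
data Pure (Stack : Set) : Set where
  ⊤ᵖ ⊥ᵖ : Pure Stack
  _≃_   : IntExpr Stack → IntExpr Stack → Pure Stack
  ¬ᵖ_   : Pure Stack → Pure Stack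
  _∧ᵖ_  : Pure Stack → Pure Stack → Pure Stack

infix 6 _≃_
infix 5 ¬ᵖ_
infixr 4 _∧ᵖ_

evalP : {Stack : Set} → Stack → Pure Stack → Bool
evalP s ⊤ᵖ = true
evalP s ⊥ᵖ = false
evalP s (x ≃ y) = does (x s ℤ.≟ y s)
evalP s (¬ᵖ F) = not (evalP s F)
evalP s (F ∧ᵖ G) = evalP s F ∧ evalP s G

_⊨ᵖ_ : {Stack : Set} → Stack → Pure Stack → Set
s ⊨ᵖ F = evalP s F ≡ true

data Spatial (Stack : Set) : Set where
  emp  : Spatial Stack
  next : IntExpr Stack → IntExpr Stack → Spatial Stack
  lseg : IntExpr Stack → IntExpr Stack → Spatial Stack

SpatialConj : Set → Set
SpatialConj Stack = List (Spatial Stack)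

Empty : {Stack : Set} → Spatial Stack → Pure Stack
Empty emp = ⊤ᵖ
Empty (next x y) = ⊥ᵖ
Empty (lseg x y) = x ≃ y

Addr : {Stack : Set} → Spatial Stack → Maybe (IntExpr Stack)
Addr emp = nothing
Addr (next x y) = just x
Addr (lseg x y) = just x

Collide : {Stack : Set} → Spatial Stack → Spatial Stack → Pure Stack
Collide emp S' = ⊥ᵖ
Collide (next x y) emp = ⊥ᵖ
Collide (lseg x y) emp = ⊥ᵖ
Collide (next x y) (next x' y') = (¬ᵖ Empty (next x y) ∧ᵖ ¬ᵖ Empty (next x' y')) ∧ᵖ (x ≃ x')
Collide (next x y) (lseg x' y') = (¬ᵖ Empty (next x y) ∧ᵖ ¬ᵖ Empty (lseg x' y')) ∧ᵖ (x ≃ x')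
Collide (lseg x y) (next x' y') = (¬ᵖ Empty (lseg x y) ∧ᵖ ¬ᵖ Empty (next x' y')) ∧ᵖ (x ≃ x')
Collide (lseg x y) (lseg x' y') = (¬ᵖ Empty (lseg x y) ∧ᵖ ¬ᵖ Empty (lseg x' y')) ∧ᵖ (x ≃ x')

noCollideWith : {Stack : Set} → Spatial Stack → SpatialConj Stack → Pure Stack
noCollideWith S [] = ⊤ᵖ
noCollideWith S (S' ∷ Σ') = ¬ᵖ Collide S S' ∧ᵖ noCollideWith S Σ'

WellFormed : {Stack : Set} → SpatialConj Stack → Pure Stack
WellFormed [] = ⊤ᵖ
WellFormed (S ∷ Σ') = noCollideWith S Σ' ∧ᵖ WellFormed Σ'

-- Heaps: partial functions ℤ ⇀ Val, with Val = ℤ (only integer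
-- values are ever stored by next / lseg).

Heap : Set
Heap = ℤ → Maybe ℤ

emptyHeap : Heap
emptyHeap a = nothing

singleton : ℤ → ℤ → Heap
singleton a v b = if does (b ℤ.≟ a) then just v else nothing

dom : Heap → ℤ → Set
dom h a = ∃[ v ] h a ≡ just v

union : Heap → Heap → Heap
union h₁ h₂ a with h₁ a
... | just v  = just v
... | nothing = h₂ a

Star : Heap → Heap → Heap → Set
Star h h₁ h₂ = (∀ a → h₁ a ≡ nothing ⊎ h₂ a ≡ nothing) × (∀ a → h a ≡ union h₁ h₂ a)

StarList : Heap → List Heap → Set
StarList h [] = ∀ a → h a ≡ nothing
StarList h (h₁ ∷ hs) = ∃[ h' ] (Star h h₁ h' × StarList h' hs)

_,_⊨ˢ_ : {Stack : Set} → Stack → Heap → Spatial Stack → Set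
s , h ⊨ˢ emp = ∀ a → h a ≡ nothing
s , h ⊨ˢ next x y = ∀ a → h a ≡ singleton (x s) (y s) a
s , h ⊨ˢ lseg x z =
  ∃[ n ] Σ (Fin (ℕ.suc n) → ℤ) λ as →
      as zero ≡ x s
    × as (fromℕ n) ≡ z s
    × (∀ (i : Fin n) → as (inject₁ i) ≢ z s)
    × StarList h (tabulate {n = n} λ i → singleton (as (inject₁ i)) (as (suc i)))

_,_⊨_ : {Stack : Set} → Stack → Heap → SpatialConj Stack → Set
s , h ⊨ [] = ∀ a → h a ≡ nothing
s , h ⊨ (S ∷ Σ') = ∃[ h₁ ] ∃[ h₂ ] (Star h h₁ h₂ × (s , h₁ ⊨ˢ S) × (s , h₂ ⊨ Σ'))

-- The witness is the canonical heap: each atom contributes the one cell at its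
-- address when it is nonempty (a list segment of length one), and nothing
-- otherwise. Well-formedness says no two nonempty atoms share an address, so
-- these contributions are pairwise disjoint, and their union is the required heap.
module Submission where

open import Defs
open import Data.Bool using (true; not; _∧_)
open import Data.Empty using (⊥; ⊥-elim)
open import Data.Fin using (zero; suc)
open import Data.Integer using (ℤ; _≟_)
open import Data.List using ([]; _∷_; foldr)
open import Data.List.Membership.Propositional using (_∈_)
open import Data.List.Relation.Unary.Any using (here; there)
open import Data.Maybe using (just; nothing)
open import Data.Product using (∃-syntax; _×_; _,_; proj₁; proj₂)
open import Data.Sum using (_⊎_; inj₁; inj₂)
open import Data.Sum.Function.Propositional using (_⊎-⇔_)
open import Function.Bundles using (_⇔_; mk⇔; Equivalence)
open import Function.Properties.Equivalence using () renaming (trans to ⇔-trans)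
open import Relation.Binary.PropositionalEquality using (_≡_; _≢_; refl; sym; trans; cong; subst)
open import Relation.Nullary using (Dec; yes; no; does; ¬_)
open import Relation.Nullary.Decidable using (dec-true; dec-false)

∧-intro : ∀ {a b} → a ≡ true → b ≡ true → a ∧ b ≡ true
∧-intro refl refl = refl

∧-elim : ∀ {a b} → a ∧ b ≡ true → a ≡ true × b ≡ true
∧-elim {true} {true} refl = refl , refl

not≡true⇒≢true : ∀ {b} → not b ≡ true → b ≢ true
not≡true⇒≢true {true} () refl

¬⇒not-does≡true : ∀ {A : Set} (A? : Dec A) → ¬ A → not (does A?) ≡ true
¬⇒not-does≡true A? ¬a = cong not (dec-false A? ¬a)

not-does≡true⇒¬ : ∀ {A : Set} (A? : Dec A) → not (does A?) ≡ true → ¬ A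
not-does≡true⇒¬ (no ¬a) _ = ¬a

dom-singleton : ∀ a v b → dom (singleton a v) b ⇔ (b ≡ a)
dom-singleton a v b = mk⇔ to from
  where
  to : dom (singleton a v) b → b ≡ a
  to _ with b ≟ a
  ... | yes b≡a = b≡a
  from : b ≡ a → dom (singleton a v) b
  from b≡a rewrite dec-true (b ≟ a) b≡a = v , refl

dom-union : ∀ h₁ h₂ a → dom (union h₁ h₂) a ⇔ (dom h₁ a ⊎ dom h₂ a)
dom-union h₁ h₂ a = mk⇔ to from
  where
  to : dom (union h₁ h₂) a → dom h₁ a ⊎ dom h₂ a
  to (v , h≡v) with h₁ a
  ... | just w  = inj₁ (w , refl)
  ... | nothing = inj₂ (v , h≡v)
  from : dom h₁ a ⊎ dom h₂ a → dom (union h₁ h₂) a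
  from (inj₁ (v , h₁≡v)) rewrite h₁≡v = v , refl
  from (inj₂ (v , h₂≡v)) with h₁ a
  ... | just w  = w , refl
  ... | nothing = v , h₂≡v

union-emptyʳ : ∀ h a → h a ≡ union h emptyHeap a
union-emptyʳ h a with h a
... | just _  = refl
... | nothing = refl

union-Star : ∀ h₁ h₂ → (∀ a → dom h₁ a → dom h₂ a → ⊥) → Star (union h₁ h₂) h₁ h₂
union-Star h₁ h₂ disjoint = separate , λ _ → refl
  where
  separate : ∀ a → h₁ a ≡ nothing ⊎ h₂ a ≡ nothing
  separate a with h₁ a in h₁≡ | h₂ a in h₂≡
  ... | nothing | _       = inj₁ refl
  ... | just _  | nothing = inj₂ refl
  ... | just v  | just w  with () ← disjoint a (v , h₁≡) (w , h₂≡)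

shortSeg : ℤ → ℤ → Heap
shortSeg a b with a ≟ b
... | yes _ = emptyHeap
... | no  _ = singleton a b

shortSeg-lseg : ∀ {Stack : Set} (s : Stack) x z → s , shortSeg (x s) (z s) ⊨ˢ lseg x z
shortSeg-lseg s x z with x s ≟ z s
... | yes x≡z = 0 , (λ _ → x s) , refl , x≡z , (λ ()) , λ _ → refl
... | no  x≢z = 1 , (λ { zero → x s ; (suc _) → z s }) , refl , refl , (λ { zero → x≢z })
              , emptyHeap , ((λ _ → inj₂ refl) , union-emptyʳ (singleton (x s) (z s))) , λ _ → refl

dom-shortSeg : ∀ a b c → dom (shortSeg a b) c ⇔ (a ≢ b × c ≡ a)
dom-shortSeg a b c with a ≟ b
... | yes a≡b = mk⇔ (λ ()) (λ (a≢b , _) → ⊥-elim (a≢b a≡b))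
... | no  a≢b = mk⇔ (λ c∈ → a≢b , Equivalence.to (dom-singleton a b c) c∈)
                    (λ (_ , c≡a) → Equivalence.from (dom-singleton a b c) c≡a)

Collide-addressed : ∀ {Stack : Set} (S S' : Spatial Stack) {x x'} →
  Addr S ≡ just x → Addr S' ≡ just x' → Collide S S' ≡ ((¬ᵖ Empty S ∧ᵖ ¬ᵖ Empty S') ∧ᵖ (x ≃ x'))
Collide-addressed (next _ _) (next _ _) refl refl = refl
Collide-addressed (next _ _) (lseg _ _) refl refl = refl
Collide-addressed (lseg _ _) (next _ _) refl refl = refl
Collide-addressed (lseg _ _) (lseg _ _) refl refl = refl

module _ {Stack : Set} (s : Stack) where

  AllocatedBy : Spatial Stack → ℤ → Set
  AllocatedBy S a = ∃[ x ] ((s ⊨ᵖ (¬ᵖ Empty S)) × Addr S ≡ just x × a ≡ x s)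

  Allocated : SpatialConj Stack → ℤ → Set
  Allocated Σ' a = ∃[ S ] ∃[ x ] (S ∈ Σ' × (s ⊨ᵖ (¬ᵖ Empty S)) × Addr S ≡ just x × a ≡ x s)

  Allocated-∷ : ∀ S Σ' a → (AllocatedBy S a ⊎ Allocated Σ' a) ⇔ Allocated (S ∷ Σ') a
  Allocated-∷ S Σ' a = mk⇔ to from
    where
    to : AllocatedBy S a ⊎ Allocated Σ' a → Allocated (S ∷ Σ') a
    to (inj₁ (x , S≠∅ , addr , a≡x))          = S , x , here refl , S≠∅ , addr , a≡x
    to (inj₂ (S' , x , S'∈Σ' , allocated))    = S' , x , there S'∈Σ' , allocated
    from : Allocated (S ∷ Σ') a → AllocatedBy S a ⊎ Allocated Σ' a
    from (_ , x , here refl , allocated)      = inj₁ (x , allocated)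
    from (S' , x , there S'∈Σ' , allocated)   = inj₂ (S' , x , S'∈Σ' , allocated)

  atomHeap : Spatial Stack → Heap
  atomHeap emp        = emptyHeap
  atomHeap (next x y) = singleton (x s) (y s)
  atomHeap (lseg x z) = shortSeg (x s) (z s)

  atomHeap-sat : ∀ S → s , atomHeap S ⊨ˢ S
  atomHeap-sat emp        _ = refl
  atomHeap-sat (next x y) _ = refl
  atomHeap-sat (lseg x z)   = shortSeg-lseg s x z

  dom-atomHeap : ∀ S a → dom (atomHeap S) a ⇔ AllocatedBy S a
  dom-atomHeap emp a = mk⇔ (λ ()) (λ ())
  dom-atomHeap (next x y) a =
    mk⇔ (λ a∈ → x , refl , refl , Equivalence.to (dom-singleton (x s) (y s) a) a∈)
        (λ { (_ , _ , refl , a≡x) → Equivalence.from (dom-singleton (x s) (y s) a) a≡x })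
  dom-atomHeap (lseg x z) a =
    mk⇔ (λ a∈ → let x≢z , a≡x = Equivalence.to (dom-shortSeg (x s) (z s) a) a∈
                 in x , ¬⇒not-does≡true (x s ≟ z s) x≢z , refl , a≡x)
        (λ { (_ , x≢z , refl , a≡x) →
           Equivalence.from (dom-shortSeg (x s) (z s) a) (not-does≡true⇒¬ (x s ≟ z s) x≢z , a≡x) })

  canonicalHeap : SpatialConj Stack → Heap
  canonicalHeap = foldr (λ S h → union (atomHeap S) h) emptyHeap

  dom-canonicalHeap : ∀ Σ' a → dom (canonicalHeap Σ') a ⇔ Allocated Σ' a
  dom-canonicalHeap []       a = mk⇔ (λ ()) (λ ())
  dom-canonicalHeap (S ∷ Σ') a =
    ⇔-trans (dom-union (atomHeap S) (canonicalHeap Σ') a)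
      (⇔-trans (dom-atomHeap S a ⊎-⇔ dom-canonicalHeap Σ' a) (Allocated-∷ S Σ' a))

  shared-address⇒Collide : ∀ S S' {a} → AllocatedBy S a → AllocatedBy S' a → s ⊨ᵖ Collide S S'
  shared-address⇒Collide S S' (x , S≠∅ , addr , a≡x) (x' , S'≠∅ , addr' , a≡x') =
    subst (s ⊨ᵖ_) (sym (Collide-addressed S S' addr addr'))
      (∧-intro (∧-intro S≠∅ S'≠∅) (dec-true (x s ≟ x' s) (trans (sym a≡x) a≡x')))

  noCollideWith-∈ : ∀ S Σ' {S'} → s ⊨ᵖ noCollideWith S Σ' → S' ∈ Σ' → ¬ (s ⊨ᵖ Collide S S')
  noCollideWith-∈ S (_ ∷ _)  ok (here refl)   = not≡true⇒≢true (proj₁ (∧-elim ok))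
  noCollideWith-∈ S (_ ∷ Σ') ok (there S'∈Σ') = noCollideWith-∈ S Σ' (proj₂ (∧-elim ok)) S'∈Σ'

  canonicalHeap-sat : ∀ Σ' → s ⊨ᵖ WellFormed Σ' → s , canonicalHeap Σ' ⊨ Σ'
  canonicalHeap-sat []       _  _ = refl
  canonicalHeap-sat (S ∷ Σ') wf =
    atomHeap S , canonicalHeap Σ' , union-Star (atomHeap S) (canonicalHeap Σ') disjoint
    , atomHeap-sat S , canonicalHeap-sat Σ' (proj₂ (∧-elim wf))
    where
    disjoint : ∀ a → dom (atomHeap S) a → dom (canonicalHeap Σ') a → ⊥
    disjoint a a∈S a∈Σ' =
      let byS = Equivalence.to (dom-atomHeap S a) a∈S
          S' , x' , S'∈Σ' , byS' = Equivalence.to (dom-canonicalHeap Σ' a) a∈Σ'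
      in noCollideWith-∈ S Σ' (proj₁ (∧-elim wf)) S'∈Σ'
           (shared-address⇒Collide S S' byS (x' , byS'))

proposition5 : {Stack : Set} (Σ' : SpatialConj Stack) (s : Stack) →
    s ⊨ᵖ WellFormed Σ' →
    ∃[ h ] ((s , h ⊨ Σ') ×
      (∀ (a : ℤ) → dom h a ⇔
        (∃[ S ] ∃[ x ] (S ∈ Σ' × (s ⊨ᵖ (¬ᵖ Empty S)) × Addr S ≡ just x × a ≡ x s))))
proposition5 Σ' s wf = canonicalHeap s Σ' , canonicalHeap-sat s Σ' wf , dom-canonicalHeap s Σ'
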